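{- For every non-negative integer $m$, \begin{align*} \sum_{n=1}^\infty n\binom{2n+1}{2m}\Big(\frac59\Big)^n&=\frac{9}{16}\Big(\frac54\Big)^m\big((6m+3)F_{4m+4}-4F_{4m+2}\big),\\ \sum_{n=1}^\infty n\binom{2n+1}{2m+1}\Big(\frac59\Big)^n&=\frac{9}{32}\Big(\frac54\Big)^m\big((6m+6)L_{4m+6}-4L_{4m+4}\big),\\ \sum_{n=1}^\infty n\binom{2n}{2m}\Big(\frac59\Big)^n&=\frac{3}{16}\Big(\frac54\Big)^m\big((6m+3)L_{4m+4}-2L_{4m+2}\big),\\ \sum_{n=1}^\infty n\binom{2n}{2m+1}\Big(\frac59\Big)^n&=\frac{15}{16}\Big(\frac54\Big)^m\big((3m+3)F_{4m+6}-F_{4m+4}\big). \end{align*}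
   Context: $F_n$ and $L_n$ are the Fibonacci and Lucas numbers ($F_0=0,F_1=1$, $L_0=2,L_1=1$, both satisfying $X_n=X_{n-1}+X_{n-2}$). Binomial coefficients $\binom{N}{j}$ vanish when $j>N$. -}

module Defs where

open import Data.Nat as ℕ using (ℕ; zero; suc)
open import Data.Nat.Combinatorics using (_C_)
open import Data.Integer using (+_)
open import Data.Rational using (ℚ; _/_; _+_; _*_; _-_; ∣_∣; _<_; 0ℚ; 1ℚ)
open import Data.Product using (∃-syntax)

fib : ℕ → ℕ
fib 0 = 0
fib 1 = 1
fib (suc (suc n)) = fib (suc n) ℕ.+ fib n

lucas : ℕ → ℕ
lucas 0 = 2
lucas 1 = 1
lucas (suc (suc n)) = lucas (suc n) ℕ.+ lucas n

ℕ→ℚ : ℕ → ℚ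
ℕ→ℚ n = + n / 1

_^ℚ_ : ℚ → ℕ → ℚ
q ^ℚ zero = 1ℚ
q ^ℚ suc k = q * (q ^ℚ k)

partialSum : (ℕ → ℚ) → ℕ → ℚ
partialSum a zero = 0ℚ
partialSum a (suc K) = partialSum a K + a (suc K)

HasSum : (ℕ → ℚ) → ℚ → Set
HasSum a L = ∀ (ε : ℚ) → 0ℚ < ε → ∃[ N ] (∀ K → N ℕ.≤ K → ∣ partialSum a K - L ∣ < ε)

-- Put x = 5/9 and σⱼ = Σ_{n≥1} C(2n, j) xⁿ. Pascal's rule applied twice gives
-- C(2n+2, j) = C(2n, j) + 2 C(2n, j−1) + C(2n, j−2), so the partial sums of σⱼ satisfy a linear
-- recurrence. The terms tend to 0: C(N, k) 3^(N−k) ≤ 4^N bounds C(2n, j+1) xⁿ by 3^(j+1), and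
-- (2n − j) C(2n, j) = (j+1) C(2n, j+1). Passing to the limit, σⱼ = (9/4)(C(2, j) x + x (2σⱼ₋₁ + σⱼ₋₂)),
-- which for j ≥ 3 reads σⱼ = (5/4)(2σⱼ₋₁ + σⱼ₋₂) and is solved by σ₂ₖ₊₁ = (5/4)ᵏ (15/8) F₄ₖ₊₄,
-- σ₂ₖ₊₂ = (5/4)ᵏ (15/16) L₄ₖ₊₆, because F(n+4) = L(n+2) + F(n) and L(n+4) = 5 F(n+2) + L(n).
-- The weight n is removed with N C(N, j) = j C(N, j) + (j+1) C(N, j+1) for N = 2n and N = 2n+1,
-- together with C(2n+1, j) = C(2n, j) + C(2n, j−1); each of the four sums thus becomes an explicit
-- combination of the σⱼ, and its agreement with the stated value is a polynomial identity once all
-- Fibonacci and Lucas numbers are expanded in the basis F(4k), F(4k+1).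

module Submission where

open import Defs
open import Data.Nat as ℕ using (ℕ; zero; suc)
import Data.Nat.Properties as ℕ
open import Data.Nat.Combinatorics using (_C_; nC1≡n; nCk+nC[k+1]≡[n+1]C[k+1])
open import Data.List using (_∷_; [])
open import Relation.Binary.PropositionalEquality

module Binomial where
  open import Data.Nat using (_+_; _*_; _∸_; _^_; _≤_; z≤n)
  open import Relation.Nullary using (yes; no)
  open import Data.Nat.Combinatorics.Specification using (k>n⇒nCk≡0)
  open import Data.Nat.Tactic.RingSolver using (solve; solve-∀)
  open import Algebra.Properties.CommutativeSemigroup ℕ.*-commutativeSemigroup
    using (interchange; x∙yz≈y∙xz; xy∙z≈xz∙y)

  n*nCk≡k*nCk+[k+1]*nC[k+1] : ∀ n k → n * (n C k) ≡ k * (n C k) + suc k * (n C suc k)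
  n*nCk≡k*nCk+[k+1]*nC[k+1] zero    zero    = refl
  n*nCk≡k*nCk+[k+1]*nC[k+1] zero    (suc k) = sym (cong₂ _+_ (ℕ.*-zeroʳ (suc k)) (ℕ.*-zeroʳ (2 + k)))
  n*nCk≡k*nCk+[k+1]*nC[k+1] (suc n) zero    = trans (ℕ.*-identityʳ (suc n)) (sym (trans (ℕ.+-identityʳ _) (nC1≡n (suc n))))
  n*nCk≡k*nCk+[k+1]*nC[k+1] (suc n) (suc k) = begin
      suc n * (suc n C suc k)
    ≡⟨ cong (suc n *_) (nCk+nC[k+1]≡[n+1]C[k+1] n k) ⟨
      suc n * (n C k + n C suc k)
    ≡⟨ step n k (n C k) (n C suc k) (n C suc (suc k)) (n*nCk≡k*nCk+[k+1]*nC[k+1] n k) (n*nCk≡k*nCk+[k+1]*nC[k+1] n (suc k)) ⟩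
      suc k * (n C k + n C suc k) + suc (suc k) * (n C suc k + n C suc (suc k))
    ≡⟨ cong₂ (λ u v → suc k * u + suc (suc k) * v) (nCk+nC[k+1]≡[n+1]C[k+1] n k) (nCk+nC[k+1]≡[n+1]C[k+1] n (suc k)) ⟩
      suc k * (suc n C suc k) + suc (suc k) * (suc n C suc (suc k))
    ∎
    where
    open ≡-Reasoning
    step : ∀ n k a b c → n * a ≡ k * a + suc k * b → n * b ≡ suc k * b + suc (suc k) * c →
           suc n * (a + b) ≡ suc k * (a + b) + suc (suc k) * (b + c)
    step n k a b c na nb = begin
        suc n * (a + b)                                             ≡⟨ solve (n ∷ a ∷ b ∷ []) ⟩
        a + b + n * a + n * b                                       ≡⟨ cong₂ (λ u v → a + b + u + v) na nb ⟩
        a + b + (k * a + suc k * b) + (suc k * b + suc (suc k) * c) ≡⟨ solve (k ∷ a ∷ b ∷ c ∷ []) ⟩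
        suc k * (a + b) + suc (suc k) * (b + c)                     ∎

  [n∸k]*nCk≡[k+1]*nC[k+1] : ∀ n k → (n ∸ k) * (n C k) ≡ suc k * (n C suc k)
  [n∸k]*nCk≡[k+1]*nC[k+1] n k = begin
      (n ∸ k) * (n C k)                                   ≡⟨ ℕ.*-distribʳ-∸ (n C k) n k ⟩
      n * (n C k) ∸ k * (n C k)                           ≡⟨ cong (_∸ k * (n C k)) (n*nCk≡k*nCk+[k+1]*nC[k+1] n k) ⟩
      k * (n C k) + suc k * (n C suc k) ∸ k * (n C k)     ≡⟨ ℕ.m+n∸m≡n (k * (n C k)) _ ⟩
      suc k * (n C suc k)                                 ∎
    where open ≡-Reasoning

  nCk*a^[n∸k]≤[1+a]^n : ∀ a n k → (n C k) * a ^ (n ∸ k) ≤ suc a ^ n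
  nCk*a^[n∸k]≤[1+a]^n a zero    zero    = ℕ.≤-refl
  nCk*a^[n∸k]≤[1+a]^n a zero    (suc k) = z≤n
  nCk*a^[n∸k]≤[1+a]^n a (suc n) zero    = ℕ.≤-trans (ℕ.≤-reflexive (ℕ.+-identityʳ _)) (ℕ.^-monoˡ-≤ (suc n) (ℕ.n≤1+n a))
  nCk*a^[n∸k]≤[1+a]^n a (suc n) (suc k) = begin
      (suc n C suc k) * a ^ (n ∸ k)
        ≡⟨ cong (_* a ^ (n ∸ k)) (nCk+nC[k+1]≡[n+1]C[k+1] n k) ⟨
      (n C k + n C suc k) * a ^ (n ∸ k)
        ≡⟨ ℕ.*-distribʳ-+ (a ^ (n ∸ k)) (n C k) (n C suc k) ⟩
      (n C k) * a ^ (n ∸ k) + (n C suc k) * a ^ (n ∸ k)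
        ≤⟨ ℕ.+-monoʳ-≤ ((n C k) * a ^ (n ∸ k)) shift ⟩
      (n C k) * a ^ (n ∸ k) + a * ((n C suc k) * a ^ (n ∸ suc k))
        ≤⟨ ℕ.+-mono-≤ (nCk*a^[n∸k]≤[1+a]^n a n k) (ℕ.*-monoʳ-≤ a (nCk*a^[n∸k]≤[1+a]^n a n (suc k))) ⟩
      suc a ^ n + a * suc a ^ n
        ∎
    where
    open ℕ.≤-Reasoning
    shift : (n C suc k) * a ^ (n ∸ k) ≤ a * ((n C suc k) * a ^ (n ∸ suc k))
    shift with suc k ℕ.≤? n
    ... | yes k<n = ℕ.≤-reflexive (begin-equality
        (n C suc k) * a ^ (n ∸ k)              ≡⟨ cong (λ e → (n C suc k) * a ^ e) (ℕ.+-∸-assoc 1 k<n) ⟩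
        (n C suc k) * (a * a ^ (n ∸ suc k))    ≡⟨ x∙yz≈y∙xz (n C suc k) a _ ⟩
        a * ((n C suc k) * a ^ (n ∸ suc k))    ∎)
    ... | no k≮n rewrite k>n⇒nCk≡0 (ℕ.≰⇒> k≮n) = z≤n

  [m*n]^o≡m^o*n^o : ∀ m n o → (m * n) ^ o ≡ m ^ o * n ^ o
  [m*n]^o≡m^o*n^o m n zero    = refl
  [m*n]^o≡m^o*n^o m n (suc o) = begin
      m * n * (m * n) ^ o       ≡⟨ cong (m * n *_) ([m*n]^o≡m^o*n^o m n o) ⟩
      m * n * (m ^ o * n ^ o)   ≡⟨ interchange m n (m ^ o) (n ^ o) ⟩
      m * m ^ o * (n * n ^ o)   ∎
    where open ≡-Reasoning

  [2n]Ck*9^n≤3^k*16^n : ∀ n k → ((2 * n) C k) * 9 ^ n ≤ 3 ^ k * 16 ^ n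
  [2n]Ck*9^n≤3^k*16^n n k = begin
      c * 9 ^ n                        ≡⟨ cong (c *_) (ℕ.^-*-assoc 3 2 n) ⟩
      c * 3 ^ (2 * n)                  ≤⟨ ℕ.*-monoʳ-≤ c (ℕ.^-monoʳ-≤ 3 (ℕ.m≤n+m∸n (2 * n) k)) ⟩
      c * 3 ^ (k + (2 * n ∸ k))        ≡⟨ cong (c *_) (ℕ.^-distribˡ-+-* 3 k (2 * n ∸ k)) ⟩
      c * (3 ^ k * 3 ^ (2 * n ∸ k))    ≡⟨ x∙yz≈y∙xz c (3 ^ k) _ ⟩
      3 ^ k * (c * 3 ^ (2 * n ∸ k))    ≤⟨ ℕ.*-monoʳ-≤ (3 ^ k) (nCk*a^[n∸k]≤[1+a]^n 3 (2 * n) k) ⟩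
      3 ^ k * 4 ^ (2 * n)              ≡⟨ cong (3 ^ k *_) (ℕ.^-*-assoc 4 2 n) ⟨
      3 ^ k * 16 ^ n                   ∎
    where
    open ℕ.≤-Reasoning
    c = (2 * n) C k

  [2n]Ck*5^n≤3^k*9^n : ∀ n k → ((2 * n) C k) * 5 ^ n ≤ 3 ^ k * 9 ^ n
  [2n]Ck*5^n≤3^k*9^n n k = ℕ.*-cancelʳ-≤ _ _ (9 ^ n) {{ℕ.m^n≢0 9 n}} (begin
      c * 5 ^ n * 9 ^ n                ≡⟨ xy∙z≈xz∙y c (5 ^ n) (9 ^ n) ⟩
      c * 9 ^ n * 5 ^ n                ≤⟨ ℕ.*-monoˡ-≤ (5 ^ n) ([2n]Ck*9^n≤3^k*16^n n k) ⟩
      3 ^ k * 16 ^ n * 5 ^ n           ≡⟨ ℕ.*-assoc (3 ^ k) (16 ^ n) (5 ^ n) ⟩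
      3 ^ k * (16 ^ n * 5 ^ n)         ≡⟨ cong (3 ^ k *_) ([m*n]^o≡m^o*n^o 16 5 n) ⟨
      3 ^ k * 80 ^ n                   ≤⟨ ℕ.*-monoʳ-≤ (3 ^ k) (ℕ.^-monoˡ-≤ n (ℕ.n≤1+n 80)) ⟩
      3 ^ k * 81 ^ n                   ≡⟨ cong (3 ^ k *_) ([m*n]^o≡m^o*n^o 9 9 n) ⟩
      3 ^ k * (9 ^ n * 9 ^ n)          ≡⟨ ℕ.*-assoc (3 ^ k) (9 ^ n) (9 ^ n) ⟨
      3 ^ k * 9 ^ n * 9 ^ n            ∎)
    where
    open ℕ.≤-Reasoning
    c = (2 * n) C k

  [2+n]C1≡nC1+[nC0+nC0] : ∀ n → (2 + n) C 1 ≡ n C 1 + (n C 0 + n C 0)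
  [2+n]C1≡nC1+[nC0+nC0] n = begin
      (2 + n) C 1         ≡⟨ nC1≡n (2 + n) ⟩
      2 + n               ≡⟨ ℕ.+-comm 2 n ⟩
      n + 2               ≡⟨ cong (_+ 2) (nC1≡n n) ⟨
      n C 1 + 2           ∎
    where open ≡-Reasoning

  [2+n]C[2+k]≡nC[2+k]+[nC[1+k]+nC[1+k]]+nCk : ∀ n k →
    (2 + n) C (2 + k) ≡ n C (2 + k) + ((n C (1 + k) + n C (1 + k)) + n C k)
  [2+n]C[2+k]≡nC[2+k]+[nC[1+k]+nC[1+k]]+nCk n k = begin
      (2 + n) C (2 + k)
    ≡⟨ nCk+nC[k+1]≡[n+1]C[k+1] (1 + n) (1 + k) ⟨
      (1 + n) C (1 + k) + (1 + n) C (2 + k)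
    ≡⟨ cong₂ _+_ (nCk+nC[k+1]≡[n+1]C[k+1] n k) (nCk+nC[k+1]≡[n+1]C[k+1] n (1 + k)) ⟨
      (n C k + n C (1 + k)) + (n C (1 + k) + n C (2 + k))
    ≡⟨ regroup (n C k) (n C (1 + k)) (n C (2 + k)) ⟩
      n C (2 + k) + ((n C (1 + k) + n C (1 + k)) + n C k)
    ∎
    where
    open ≡-Reasoning
    regroup : ∀ a b c → (a + b) + (b + c) ≡ c + ((b + b) + a)
    regroup = solve-∀

module Fibonacci where
  open import Data.Nat using (_+_; _*_)
  open import Data.Nat.Tactic.RingSolver using (solve-∀)
  open import Algebra.Properties.CommutativeSemigroup ℕ.+-commutativeSemigroup
    using () renaming (interchange to +-interchange)

  FibLike : (ℕ → ℕ) → Set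
  FibLike X = ∀ n → X (2 + n) ≡ X (1 + n) + X n

  fib-fibLike : FibLike fib
  fib-fibLike n = refl

  lucas-fibLike : FibLike lucas
  lucas-fibLike n = refl

  fibLike-+ : ∀ X → FibLike X → ∀ c n → X (suc c + n) ≡ X c * fib n + X (suc c) * fib (suc n)
  fibLike-+ X rec c zero = begin
      X (suc c + 0)               ≡⟨ cong X (ℕ.+-identityʳ (suc c)) ⟩
      X (suc c)                   ≡⟨ ℕ.*-identityʳ (X (suc c)) ⟨
      X (suc c) * 1               ≡⟨ cong (_+ X (suc c) * 1) (ℕ.*-zeroʳ (X c)) ⟨
      X c * 0 + X (suc c) * 1     ∎
    where open ≡-Reasoning
  fibLike-+ X rec c (suc n) = begin
      X (suc c + suc n)                                   ≡⟨ cong X (ℕ.+-suc (suc c) n) ⟩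
      X (suc (suc c) + n)                                 ≡⟨ fibLike-+ X rec (suc c) n ⟩
      X (suc c) * fib n + X (2 + c) * fib (suc n)         ≡⟨ cong (λ y → X (suc c) * fib n + y * fib (suc n)) (rec c) ⟩
      X (suc c) * fib n + (X (suc c) + X c) * fib (suc n) ≡⟨ regroup (X (suc c)) (X c) (fib n) (fib (suc n)) ⟩
      X c * fib (suc n) + X (suc c) * (fib (suc n) + fib n) ∎
    where
    open ≡-Reasoning
    regroup : ∀ a b f g → a * f + (a + b) * g ≡ b * g + a * (g + f)
    regroup = solve-∀

  fib[4+n]≡lucas[2+n]+fib[n] : ∀ n → fib (4 + n) ≡ lucas (2 + n) + fib n
  fib[4+n]≡lucas[2+n]+fib[n] zero          = refl
  fib[4+n]≡lucas[2+n]+fib[n] (suc zero)    = refl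
  fib[4+n]≡lucas[2+n]+fib[n] (suc (suc n)) =
    trans (cong₂ _+_ (fib[4+n]≡lucas[2+n]+fib[n] (suc n)) (fib[4+n]≡lucas[2+n]+fib[n] n))
          (+-interchange (lucas (3 + n)) (fib (suc n)) (lucas (2 + n)) (fib n))

  lucas[4+n]≡5*fib[2+n]+lucas[n] : ∀ n → lucas (4 + n) ≡ 5 * fib (2 + n) + lucas n
  lucas[4+n]≡5*fib[2+n]+lucas[n] zero          = refl
  lucas[4+n]≡5*fib[2+n]+lucas[n] (suc zero)    = refl
  lucas[4+n]≡5*fib[2+n]+lucas[n] (suc (suc n)) =
    trans (cong₂ _+_ (lucas[4+n]≡5*fib[2+n]+lucas[n] (suc n)) (lucas[4+n]≡5*fib[2+n]+lucas[n] n))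
          (regroup (fib (3 + n)) (lucas (suc n)) (fib (2 + n)) (lucas n))
    where
    regroup : ∀ a b c d → (5 * a + b) + (5 * c + d) ≡ 5 * (a + c) + (b + d)
    regroup = solve-∀

open Binomial
open Fibonacci

-- Imported only here: in the modules above, _+_ and _*_ are those of ℕ.
open import Data.Integer as ℤ using (+_; -[1+_])
import Data.Integer.Properties as ℤ
open import Data.Rational
  using (ℚ; _/_; _+_; _*_; _-_; -_; 0ℚ; 1ℚ; mkℚ; ∣_∣; _<_; _≤_; 1/_; Positive; NonNegative; NonZero; *<*; positive; nonNegative)
open import Data.Rational.Properties
import Data.Nat.Coprimality as Coprimality
import Data.Nat.Tactic.RingSolver as NatSolver
open import Data.Product using (_×_; _,_; proj₁; proj₂; ∃-syntax)
open import Level using (0ℓ)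
open import Algebra.Bundles using (CommutativeRing)
open import Algebra.Properties.CommutativeSemigroup (CommutativeRing.*-commutativeSemigroup +-*-commutativeRing)
  using (xy∙z≈zx∙y; x∙yz≈y∙xz) renaming (interchange to *-interchange)
open import Algebra.Properties.CommutativeSemigroup (CommutativeRing.+-commutativeSemigroup +-*-commutativeRing)
  using () renaming (interchange to +-interchange)
open import Relation.Nullary.Decidable using (dec⇒maybe)
open import Tactic.RingSolver using (solve-∀; solve)
open import Tactic.RingSolver.Core.AlmostCommutativeRing using (AlmostCommutativeRing; fromCommutativeRing)

ℚ-ring : AlmostCommutativeRing 0ℓ 0ℓ
ℚ-ring = fromCommutativeRing +-*-commutativeRing (λ p → dec⇒maybe (0ℚ ≟ p))

-- Natural numbers as rationals

ℕ→ℚ≡mkℚ : ∀ n → ℕ→ℚ n ≡ mkℚ (+ n) 0 (Coprimality.sym (Coprimality.1-coprimeTo n))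
ℕ→ℚ≡mkℚ n = normalize-coprime (Coprimality.sym (Coprimality.1-coprimeTo n))

ℕ→ℚ-suc : ∀ n → ℕ→ℚ (suc n) ≡ 1ℚ + ℕ→ℚ n
ℕ→ℚ-suc n rewrite ℕ→ℚ≡mkℚ n = /-cong (cong (λ i → + 1 ℤ.+ i) (sym (ℤ.*-identityʳ (+ n)))) refl

ℕ→ℚ-+ : ∀ m n → ℕ→ℚ (m ℕ.+ n) ≡ ℕ→ℚ m + ℕ→ℚ n
ℕ→ℚ-+ zero    n = sym (+-identityˡ (ℕ→ℚ n))
ℕ→ℚ-+ (suc m) n = begin
    ℕ→ℚ (suc (m ℕ.+ n))       ≡⟨ ℕ→ℚ-suc (m ℕ.+ n) ⟩
    1ℚ + ℕ→ℚ (m ℕ.+ n)        ≡⟨ cong (λ q → 1ℚ + q) (ℕ→ℚ-+ m n) ⟩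
    1ℚ + (ℕ→ℚ m + ℕ→ℚ n)      ≡⟨ +-assoc 1ℚ (ℕ→ℚ m) (ℕ→ℚ n) ⟨
    1ℚ + ℕ→ℚ m + ℕ→ℚ n        ≡⟨ cong (_+ ℕ→ℚ n) (ℕ→ℚ-suc m) ⟨
    ℕ→ℚ (suc m) + ℕ→ℚ n       ∎
  where open ≡-Reasoning

ℕ→ℚ-* : ∀ m n → ℕ→ℚ (m ℕ.* n) ≡ ℕ→ℚ m * ℕ→ℚ n
ℕ→ℚ-* zero    n = sym (*-zeroˡ (ℕ→ℚ n))
ℕ→ℚ-* (suc m) n = begin
    ℕ→ℚ (n ℕ.+ m ℕ.* n)       ≡⟨ ℕ→ℚ-+ n (m ℕ.* n) ⟩
    ℕ→ℚ n + ℕ→ℚ (m ℕ.* n)     ≡⟨ cong (λ q → ℕ→ℚ n + q) (ℕ→ℚ-* m n) ⟩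
    ℕ→ℚ n + ℕ→ℚ m * ℕ→ℚ n     ≡⟨ cong (_+ ℕ→ℚ m * ℕ→ℚ n) (*-identityˡ (ℕ→ℚ n)) ⟨
    1ℚ * ℕ→ℚ n + ℕ→ℚ m * ℕ→ℚ n ≡⟨ *-distribʳ-+ (ℕ→ℚ n) 1ℚ (ℕ→ℚ m) ⟨
    (1ℚ + ℕ→ℚ m) * ℕ→ℚ n      ≡⟨ cong (_* ℕ→ℚ n) (ℕ→ℚ-suc m) ⟨
    ℕ→ℚ (suc m) * ℕ→ℚ n       ∎
  where open ≡-Reasoning

ℕ→ℚ-^ : ∀ m n → ℕ→ℚ (m ℕ.^ n) ≡ ℕ→ℚ m ^ℚ n
ℕ→ℚ-^ m zero    = refl
ℕ→ℚ-^ m (suc n) = trans (ℕ→ℚ-* m (m ℕ.^ n)) (cong (ℕ→ℚ m *_) (ℕ→ℚ-^ m n))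

^ℚ-distribʳ-* : ∀ p q n → (p * q) ^ℚ n ≡ p ^ℚ n * q ^ℚ n
^ℚ-distribʳ-* p q zero    = refl
^ℚ-distribʳ-* p q (suc n) =
  trans (cong (p * q *_) (^ℚ-distribʳ-* p q n)) (*-interchange p q (p ^ℚ n) (q ^ℚ n))

ℕ→ℚ-+-* : ∀ a b y → ℕ→ℚ (a ℕ.+ b) * y ≡ ℕ→ℚ a * y + ℕ→ℚ b * y
ℕ→ℚ-+-* a b y = trans (cong (_* y) (ℕ→ℚ-+ a b)) (*-distribʳ-+ y (ℕ→ℚ a) (ℕ→ℚ b))

ℕ→ℚ-c+a*k : ∀ c a k → ℕ→ℚ (c ℕ.+ a ℕ.* k) ≡ ℕ→ℚ c + ℕ→ℚ a * ℕ→ℚ k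
ℕ→ℚ-c+a*k c a k = trans (ℕ→ℚ-+ c (a ℕ.* k)) (cong (λ q → ℕ→ℚ c + q) (ℕ→ℚ-* a k))

ℕ→ℚ-a*k+c : ∀ a k c → ℕ→ℚ (a ℕ.* k ℕ.+ c) ≡ ℕ→ℚ a * ℕ→ℚ k + ℕ→ℚ c
ℕ→ℚ-a*k+c a k c = trans (ℕ→ℚ-+ (a ℕ.* k) c) (cong (_+ ℕ→ℚ c) (ℕ→ℚ-* a k))

0≤ℕ→ℚ : ∀ n → 0ℚ ≤ ℕ→ℚ n
0≤ℕ→ℚ n = nonNegative⁻¹ (ℕ→ℚ n) {{normalize-nonNeg n 1}}

ℕ→ℚ-mono-≤ : ∀ {m n} → m ℕ.≤ n → ℕ→ℚ m ≤ ℕ→ℚ n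
ℕ→ℚ-mono-≤ {m} m≤n with ℕ.m≤n⇒∃[o]m+o≡n m≤n
... | o , refl = begin
    ℕ→ℚ m                ≡⟨ +-identityʳ (ℕ→ℚ m) ⟨
    ℕ→ℚ m + 0ℚ           ≤⟨ +-monoʳ-≤ (ℕ→ℚ m) (0≤ℕ→ℚ o) ⟩
    ℕ→ℚ m + ℕ→ℚ o        ≡⟨ ℕ→ℚ-+ m o ⟨
    ℕ→ℚ (m ℕ.+ o)        ∎
  where open ≤-Reasoning

-- Limits and series

infix 4 _⟶_
_⟶_ : (ℕ → ℚ) → ℚ → Set
s ⟶ L = ∀ ε → 0ℚ < ε → ∃[ N ] (∀ n → N ℕ.≤ n → ∣ s n - L ∣ < ε)

½ : ℚ
½ = + 1 / 2

0<½*ε : ∀ {ε} → 0ℚ < ε → 0ℚ < ½ * ε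
0<½*ε {ε} ε>0 = subst (_< ½ * ε) (*-zeroʳ ½) (*-monoʳ-<-pos ½ ε>0)

⟶-cong : ∀ {s t L} → (∀ n → s n ≡ t n) → s ⟶ L → t ⟶ L
⟶-cong {L = L} s≡t s⟶L ε ε>0 with s⟶L ε ε>0
... | N , close = N , λ n N≤n → subst (λ v → ∣ v - L ∣ < ε) (s≡t n) (close n N≤n)

⟶-const : ∀ c → (λ _ → c) ⟶ c
⟶-const c ε ε>0 = 0 , λ _ _ → subst (_< ε) (sym (cong ∣_∣ (+-inverseʳ c))) ε>0

⟶-∘suc : ∀ {s L} → s ⟶ L → (λ n → s (suc n)) ⟶ L
⟶-∘suc s⟶L ε ε>0 with s⟶L ε ε>0
... | N , close = N , λ n N≤n → close (suc n) (ℕ.m≤n⇒m≤1+n N≤n)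

⟶-+ : ∀ {s t a b} → s ⟶ a → t ⟶ b → (λ n → s n + t n) ⟶ a + b
⟶-+ {s} {t} {a} {b} s⟶a t⟶b ε ε>0 with s⟶a (½ * ε) (0<½*ε ε>0) | t⟶b (½ * ε) (0<½*ε ε>0)
... | N₁ , close₁ | N₂ , close₂ = N₁ ℕ.⊔ N₂ , λ n N≤n → begin-strict
    ∣ (s n + t n) - (a + b) ∣   ≡⟨ cong ∣_∣ (regroup (s n) (t n) a b) ⟩
    ∣ (s n - a) + (t n - b) ∣   ≤⟨ ∣p+q∣≤∣p∣+∣q∣ (s n - a) (t n - b) ⟩
    ∣ s n - a ∣ + ∣ t n - b ∣   <⟨ +-mono-< (close₁ n (ℕ.m⊔n≤o⇒m≤o N₁ N₂ N≤n)) (close₂ n (ℕ.m⊔n≤o⇒n≤o N₁ N₂ N≤n)) ⟩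
    ½ * ε + ½ * ε               ≡⟨ halves ε ⟩
    ε                           ∎
  where
  open ≤-Reasoning
  regroup : ∀ x y a b → (x + y) - (a + b) ≡ (x - a) + (y - b)
  regroup = solve-∀ ℚ-ring
  halves : ∀ e → ½ * e + ½ * e ≡ e
  halves = solve-∀ ℚ-ring

⟶-* : ∀ c {s L} → s ⟶ L → (λ n → c * s n) ⟶ c * L
⟶-* c {s} {L} s⟶L ε ε>0 = proj₁ (s⟶L δ δ>0) , close
  where
  open ≤-Reasoning
  M = ∣ c ∣ + 1ℚ
  instance
    M-pos : Positive M
    M-pos = nonNeg+pos⇒pos ∣ c ∣ {{∣-∣-nonNeg c}} 1ℚ
    M-nonZero : NonZero M
    M-nonZero = pos⇒nonZero M
  δ = ε * 1/ M
  δ>0 : 0ℚ < δ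
  δ>0 = positive⁻¹ δ {{pos*pos⇒pos ε {{positive ε>0}} (1/ M) {{1/pos⇒pos M}}}}
  ∣c∣≤M : ∣ c ∣ ≤ M
  ∣c∣≤M = subst (_≤ M) (+-identityʳ ∣ c ∣) (+-monoʳ-≤ ∣ c ∣ (nonNegative⁻¹ 1ℚ))
  factor : ∀ c x y → c * x - c * y ≡ c * (x - y)
  factor = solve-∀ ℚ-ring
  cancel : ∀ x e y → x * (e * y) ≡ e * (x * y)
  cancel = solve-∀ ℚ-ring
  close : ∀ n → proj₁ (s⟶L δ δ>0) ℕ.≤ n → ∣ c * s n - c * L ∣ < ε
  close n N≤n = begin-strict
    ∣ c * s n - c * L ∣        ≡⟨ cong ∣_∣ (factor c (s n) L) ⟩
    ∣ c * (s n - L) ∣          ≡⟨ ∣p*q∣≡∣p∣*∣q∣ c (s n - L) ⟩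
    ∣ c ∣ * ∣ s n - L ∣        ≤⟨ *-monoʳ-≤-nonNeg ∣ s n - L ∣ {{∣-∣-nonNeg (s n - L)}} ∣c∣≤M ⟩
    M * ∣ s n - L ∣            <⟨ *-monoʳ-<-pos M (proj₂ (s⟶L δ δ>0) n N≤n) ⟩
    M * δ                      ≡⟨ cancel M ε (1/ M) ⟩
    ε * (M * 1/ M)             ≡⟨ cong (ε *_) (*-inverseʳ M) ⟩
    ε * 1ℚ                     ≡⟨ *-identityʳ ε ⟩
    ε                          ∎

⟶-- : ∀ {s t a b} → s ⟶ a → t ⟶ b → (λ n → s n - t n) ⟶ a - b
⟶-- {s} {t} {a} {b} s⟶a t⟶b =
  subst ((λ n → s n - t n) ⟶_) (minus a b) (⟶-cong (λ n → minus (s n) (t n)) (⟶-+ {s} {λ n → - 1ℚ * t n} s⟶a (⟶-* (- 1ℚ) {t} t⟶b)))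
  where
  minus : ∀ x y → x + - 1ℚ * y ≡ x - y
  minus = solve-∀ ℚ-ring

ℕ→ℚ-unbounded : ∀ p → ∃[ M ] (p < ℕ→ℚ M)
ℕ→ℚ-unbounded p@(mkℚ (+ n) d _) = suc n , subst (p <_) (sym (ℕ→ℚ≡mkℚ (suc n)))
  (*<* (subst₂ ℤ._<_ (ℤ.pos-* n 1) (ℤ.pos-* (suc n) (suc d))
    (ℤ.+<+ (ℕ.≤-trans (ℕ.s≤s (ℕ.≤-reflexive (ℕ.*-identityʳ n))) (ℕ.m≤m*n (suc n) (suc d))))))
ℕ→ℚ-unbounded p@(mkℚ -[1+ n ] d _) = 0 , negative⁻¹ p

s*[n∸j]≤D⇒s⟶0 : ∀ {s : ℕ → ℚ} j D → (∀ n → 0ℚ ≤ s n) → (∀ n → s n * ℕ→ℚ (n ℕ.∸ j) ≤ D) → s ⟶ 0ℚ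
s*[n∸j]≤D⇒s⟶0 {s} j D s≥0 bound ε ε>0 = j ℕ.+ M , close
  where
  open ≤-Reasoning
  instance
    ε-nonZero : NonZero ε
    ε-nonZero = pos⇒nonZero ε {{positive ε>0}}
  M = proj₁ (ℕ→ℚ-unbounded (D * 1/ ε))
  D<M*ε : D < ℕ→ℚ M * ε
  D<M*ε = begin-strict
    D                   ≡⟨ *-identityʳ D ⟨
    D * 1ℚ              ≡⟨ cong (D *_) (*-inverseˡ ε) ⟨
    D * (1/ ε * ε)      ≡⟨ *-assoc D (1/ ε) ε ⟨
    D * 1/ ε * ε        <⟨ *-monoˡ-<-pos ε {{positive ε>0}} (proj₂ (ℕ→ℚ-unbounded (D * 1/ ε))) ⟩
    ℕ→ℚ M * ε           ∎
  close : ∀ n → j ℕ.+ M ℕ.≤ n → ∣ s n - 0ℚ ∣ < ε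
  close n j+M≤n = subst (_< ε) (sym ∣s-0∣≡s) (*-cancelʳ-<-nonNeg (ℕ→ℚ M) {{normalize-nonNeg M 1}} (begin-strict
    s n * ℕ→ℚ M             ≤⟨ *-monoˡ-≤-nonNeg (s n) {{nonNegative (s≥0 n)}} (ℕ→ℚ-mono-≤ M≤n∸j) ⟩
    s n * ℕ→ℚ (n ℕ.∸ j)     ≤⟨ bound n ⟩
    D                       <⟨ D<M*ε ⟩
    ℕ→ℚ M * ε               ≡⟨ *-comm (ℕ→ℚ M) ε ⟩
    ε * ℕ→ℚ M               ∎))
    where
    M≤n∸j : M ℕ.≤ n ℕ.∸ j
    M≤n∸j = subst (ℕ._≤ n ℕ.∸ j) (ℕ.m+n∸m≡n j M) (ℕ.∸-monoˡ-≤ j j+M≤n)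
    ∣s-0∣≡s : ∣ s n - 0ℚ ∣ ≡ s n
    ∣s-0∣≡s = trans (cong ∣_∣ (+-identityʳ (s n))) (0≤p⇒∣p∣≡p (s≥0 n))

partialSum-cong : ∀ {a b : ℕ → ℚ} → (∀ n → a n ≡ b n) → ∀ K → partialSum a K ≡ partialSum b K
partialSum-cong a≡b zero    = refl
partialSum-cong a≡b (suc K) = cong₂ _+_ (partialSum-cong a≡b K) (a≡b (suc K))

partialSum-+ : ∀ a b K → partialSum (λ n → a n + b n) K ≡ partialSum a K + partialSum b K
partialSum-+ a b zero    = refl
partialSum-+ a b (suc K) =
  trans (cong (_+ (a (suc K) + b (suc K))) (partialSum-+ a b K))
        (+-interchange (partialSum a K) (partialSum b K) (a (suc K)) (b (suc K)))

partialSum-* : ∀ c a K → partialSum (λ n → c * a n) K ≡ c * partialSum a K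
partialSum-* c a zero    = sym (*-zeroʳ c)
partialSum-* c a (suc K) =
  trans (cong (_+ c * a (suc K)) (partialSum-* c a K)) (sym (*-distribˡ-+ c (partialSum a K) (a (suc K))))

partialSum-0 : ∀ K → partialSum (λ _ → 0ℚ) K ≡ 0ℚ
partialSum-0 zero    = refl
partialSum-0 (suc K) = trans (+-identityʳ _) (partialSum-0 K)

partialSum-suc : ∀ a K → partialSum a (suc K) ≡ a 1 + partialSum (λ n → a (suc n)) K
partialSum-suc a zero    = trans (+-identityˡ (a 1)) (sym (+-identityʳ (a 1)))
partialSum-suc a (suc K) = trans (cong (_+ a (2 ℕ.+ K)) (partialSum-suc a K)) (+-assoc (a 1) _ _)

hasSum-cong : ∀ {a b L} → (∀ n → a n ≡ b n) → HasSum a L → HasSum b L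
hasSum-cong a≡b = ⟶-cong (partialSum-cong a≡b)

hasSum-0 : HasSum (λ _ → 0ℚ) 0ℚ
hasSum-0 = ⟶-cong {L = 0ℚ} (λ K → sym (partialSum-0 K)) (⟶-const 0ℚ)

hasSum-+ : ∀ {a b A B} → HasSum a A → HasSum b B → HasSum (λ n → a n + b n) (A + B)
hasSum-+ {a} {b} Σa Σb = ⟶-cong (λ K → sym (partialSum-+ a b K)) (⟶-+ {partialSum a} {partialSum b} Σa Σb)

hasSum-* : ∀ c {a A} → HasSum a A → HasSum (λ n → c * a n) (c * A)
hasSum-* c {a} Σa = ⟶-cong (λ K → sym (partialSum-* c a K)) (⟶-* c {partialSum a} Σa)

hasSum-- : ∀ {a b A B} → HasSum a A → HasSum b B → HasSum (λ n → a n - b n) (A - B)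
hasSum-- {a} {b} {A} {B} ΣA ΣB = subst (HasSum (λ n → a n - b n)) (minus A B)
  (hasSum-cong (λ n → minus (a n) (b n)) (hasSum-+ {a} {λ n → - 1ℚ * b n} ΣA (hasSum-* (- 1ℚ) {b} ΣB)))
  where
  minus : ∀ x y → x + - 1ℚ * y ≡ x - y
  minus = solve-∀ ℚ-ring

hasSum-recurrence : ∀ {x r C} {t c : ℕ → ℚ} → r * (1ℚ - x) ≡ 1ℚ → (∀ n → t (suc n) ≡ x * (t n + c n)) →
                    t ⟶ 0ℚ → HasSum c C → HasSum t (r * (t 1 + x * C))
hasSum-recurrence {x} {r} {C} {t} {c} r[1-x]≡1 step t⟶0 Σc =
  ⟶-cong (λ K → sym (solved K))
    (subst (λ L → (λ K → r * (t 1 + x * partialSum c K - t (suc K))) ⟶ r * L) (+-identityʳ (t 1 + x * C))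
      (⟶-* r (⟶-- {λ K → t 1 + x * partialSum c K} {λ K → t (suc K)} {t 1 + x * C} {0ℚ}
                  (⟶-+ {λ _ → t 1} {λ K → x * partialSum c K} (⟶-const (t 1)) (⟶-* x {partialSum c} Σc))
                  (⟶-∘suc {t} {0ℚ} t⟶0))))
  where
  open ≡-Reasoning
  unfolded : ∀ K → partialSum t K + t (suc K) ≡ t 1 + x * (partialSum t K + partialSum c K)
  unfolded K = begin
    partialSum t (suc K)                                ≡⟨ partialSum-suc t K ⟩
    t 1 + partialSum (λ n → t (suc n)) K                ≡⟨ cong (λ s → t 1 + s) (partialSum-cong step K) ⟩
    t 1 + partialSum (λ n → x * (t n + c n)) K          ≡⟨ cong (λ s → t 1 + s) (partialSum-* x (λ n → t n + c n) K) ⟩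
    t 1 + x * partialSum (λ n → t n + c n) K            ≡⟨ cong (λ s → t 1 + x * s) (partialSum-+ t c K) ⟩
    t 1 + x * (partialSum t K + partialSum c K)         ∎
  solve-for : ∀ S u T P → S + u ≡ T + x * (S + P) → S ≡ r * (T + x * P - u)
  solve-for S u T P eq = begin
    S                                    ≡⟨ *-identityˡ S ⟨
    1ℚ * S                               ≡⟨ cong (_* S) r[1-x]≡1 ⟨
    r * (1ℚ - x) * S                     ≡⟨ lhs r x S u P ⟩
    r * ((S + u) - x * (S + P) + x * P - u) ≡⟨ cong (λ v → r * (v - x * (S + P) + x * P - u)) eq ⟩
    r * ((T + x * (S + P)) - x * (S + P) + x * P - u) ≡⟨ rhs r x S T P u ⟩
    r * (T + x * P - u)                  ∎
    where
    lhs : ∀ r x S u P → r * (1ℚ - x) * S ≡ r * ((S + u) - x * (S + P) + x * P - u)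
    lhs = solve-∀ ℚ-ring
    rhs : ∀ r x S T P u → r * ((T + x * (S + P)) - x * (S + P) + x * P - u) ≡ r * (T + x * P - u)
    rhs = solve-∀ ℚ-ring
  solved : ∀ K → partialSum t K ≡ r * (t 1 + x * partialSum c K - t (suc K))
  solved K = solve-for (partialSum t K) (t (suc K)) (t 1) (partialSum c K) (unfolded K)

-- The series Σₙ C(2n, j) (5/9)ⁿ

x : ℚ
x = + 5 / 9

t : ℕ → ℕ → ℚ
t j n = ℕ→ℚ ((2 ℕ.* n) C j) * x ^ℚ n

t-nonNeg : ∀ j n → 0ℚ ≤ t j n
t-nonNeg j n = nonNegative⁻¹ (t j n)
  {{nonNeg*nonNeg⇒nonNeg (ℕ→ℚ ((2 ℕ.* n) C j)) {{nonNegative (0≤ℕ→ℚ ((2 ℕ.* n) C j))}} (x ^ℚ n) {{x^n-nonNeg n}}}}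
  where
  x^n-nonNeg : ∀ n → NonNegative (x ^ℚ n)
  x^n-nonNeg zero    = _
  x^n-nonNeg (suc n) = nonNeg*nonNeg⇒nonNeg x (x ^ℚ n) {{x^n-nonNeg n}}

x^n*9^n≡5^n : ∀ n → x ^ℚ n * ℕ→ℚ (9 ℕ.^ n) ≡ ℕ→ℚ (5 ℕ.^ n)
x^n*9^n≡5^n n = begin
    x ^ℚ n * ℕ→ℚ (9 ℕ.^ n)         ≡⟨ cong (x ^ℚ n *_) (ℕ→ℚ-^ 9 n) ⟩
    x ^ℚ n * ℕ→ℚ 9 ^ℚ n            ≡⟨ ^ℚ-distribʳ-* x (ℕ→ℚ 9) n ⟨
    (x * ℕ→ℚ 9) ^ℚ n               ≡⟨ ℕ→ℚ-^ 5 n ⟨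
    ℕ→ℚ (5 ℕ.^ n)                  ∎
  where open ≡-Reasoning

t≤3^j : ∀ j n → t j n ≤ ℕ→ℚ (3 ℕ.^ j)
t≤3^j j n = *-cancelʳ-≤-pos (ℕ→ℚ (9 ℕ.^ n)) {{normalize-pos (9 ℕ.^ n) 1 {{_}} {{ℕ.m^n≢0 9 n}}}} (begin
    ℕ→ℚ c * x ^ℚ n * ℕ→ℚ (9 ℕ.^ n)     ≡⟨ *-assoc (ℕ→ℚ c) (x ^ℚ n) _ ⟩
    ℕ→ℚ c * (x ^ℚ n * ℕ→ℚ (9 ℕ.^ n))   ≡⟨ cong (ℕ→ℚ c *_) (x^n*9^n≡5^n n) ⟩
    ℕ→ℚ c * ℕ→ℚ (5 ℕ.^ n)              ≡⟨ ℕ→ℚ-* c (5 ℕ.^ n) ⟨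
    ℕ→ℚ (c ℕ.* 5 ℕ.^ n)                ≤⟨ ℕ→ℚ-mono-≤ ([2n]Ck*5^n≤3^k*9^n n j) ⟩
    ℕ→ℚ (3 ℕ.^ j ℕ.* 9 ℕ.^ n)          ≡⟨ ℕ→ℚ-* (3 ℕ.^ j) (9 ℕ.^ n) ⟩
    ℕ→ℚ (3 ℕ.^ j) * ℕ→ℚ (9 ℕ.^ n)      ∎)
  where
  open ≤-Reasoning
  c = (2 ℕ.* n) C j

t*[2n∸j]≡[j+1]*t[j+1] : ∀ j n → t j n * ℕ→ℚ (2 ℕ.* n ℕ.∸ j) ≡ ℕ→ℚ (suc j) * t (suc j) n
t*[2n∸j]≡[j+1]*t[j+1] j n = begin
    ℕ→ℚ c * x ^ℚ n * ℕ→ℚ (2 ℕ.* n ℕ.∸ j)          ≡⟨ xy∙z≈zx∙y (ℕ→ℚ c) (x ^ℚ n) _ ⟩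
    ℕ→ℚ (2 ℕ.* n ℕ.∸ j) * ℕ→ℚ c * x ^ℚ n          ≡⟨ cong (_* x ^ℚ n) (ℕ→ℚ-* (2 ℕ.* n ℕ.∸ j) c) ⟨
    ℕ→ℚ ((2 ℕ.* n ℕ.∸ j) ℕ.* c) * x ^ℚ n          ≡⟨ cong (λ m → ℕ→ℚ m * x ^ℚ n) ([n∸k]*nCk≡[k+1]*nC[k+1] (2 ℕ.* n) j) ⟩
    ℕ→ℚ (suc j ℕ.* ((2 ℕ.* n) C suc j)) * x ^ℚ n  ≡⟨ cong (_* x ^ℚ n) (ℕ→ℚ-* (suc j) ((2 ℕ.* n) C suc j)) ⟩
    ℕ→ℚ (suc j) * ℕ→ℚ ((2 ℕ.* n) C suc j) * x ^ℚ n ≡⟨ *-assoc (ℕ→ℚ (suc j)) _ (x ^ℚ n) ⟩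
    ℕ→ℚ (suc j) * t (suc j) n                     ∎
  where
  open ≡-Reasoning
  c = (2 ℕ.* n) C j

t⟶0 : ∀ j → t j ⟶ 0ℚ
t⟶0 j = s*[n∸j]≤D⇒s⟶0 j (ℕ→ℚ (suc j) * ℕ→ℚ (3 ℕ.^ suc j)) (t-nonNeg j) λ n → begin
    t j n * ℕ→ℚ (n ℕ.∸ j)               ≤⟨ *-monoˡ-≤-nonNeg (t j n) {{nonNegative (t-nonNeg j n)}} (ℕ→ℚ-mono-≤ (ℕ.∸-monoˡ-≤ j (ℕ.m≤m+n n (n ℕ.+ 0)))) ⟩
    t j n * ℕ→ℚ (2 ℕ.* n ℕ.∸ j)         ≡⟨ t*[2n∸j]≡[j+1]*t[j+1] j n ⟩
    ℕ→ℚ (suc j) * t (suc j) n           ≤⟨ *-monoˡ-≤-nonNeg (ℕ→ℚ (suc j)) {{nonNegative (0≤ℕ→ℚ (suc j))}} (t≤3^j (suc j) n) ⟩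
    ℕ→ℚ (suc j) * ℕ→ℚ (3 ℕ.^ suc j)     ∎
  where open ≤-Reasoning

lower : ℕ → ℕ → ℚ
lower zero          n = 0ℚ
lower (suc zero)    n = t 0 n + t 0 n
lower (suc (suc j)) n = (t (suc j) n + t (suc j) n) + t j n

t-suc : ∀ j n → t j (suc n) ≡ x * (ℕ→ℚ ((2 ℕ.+ 2 ℕ.* n) C j) * x ^ℚ n)
t-suc j n = trans (cong (λ m → ℕ→ℚ (m C j) * (x * x ^ℚ n)) (ℕ.*-suc 2 n)) (x∙yz≈y∙xz (ℕ→ℚ ((2 ℕ.+ 2 ℕ.* n) C j)) x (x ^ℚ n))

t-step : ∀ j n → t j (suc n) ≡ x * (t j n + lower j n)
t-step zero          n = trans (t-suc 0 n) (cong (x *_) (sym (+-identityʳ (t 0 n))))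
t-step (suc zero)    n = trans (t-suc 1 n) (cong (x *_) (begin
    ℕ→ℚ ((2 ℕ.+ N) C 1) * y                            ≡⟨ cong (λ m → ℕ→ℚ m * y) ([2+n]C1≡nC1+[nC0+nC0] N) ⟩
    ℕ→ℚ (N C 1 ℕ.+ (N C 0 ℕ.+ N C 0)) * y              ≡⟨ ℕ→ℚ-+-* (N C 1) _ y ⟩
    t 1 n + ℕ→ℚ (N C 0 ℕ.+ N C 0) * y                  ≡⟨ cong (λ q → t 1 n + q) (ℕ→ℚ-+-* (N C 0) (N C 0) y) ⟩
    t 1 n + (t 0 n + t 0 n)                            ∎))
  where
  open ≡-Reasoning
  N = 2 ℕ.* n
  y = x ^ℚ n
t-step (suc (suc j)) n = trans (t-suc (2 ℕ.+ j) n) (cong (x *_) (begin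
    ℕ→ℚ ((2 ℕ.+ N) C (2 ℕ.+ j)) * y
      ≡⟨ cong (λ m → ℕ→ℚ m * y) ([2+n]C[2+k]≡nC[2+k]+[nC[1+k]+nC[1+k]]+nCk N j) ⟩
    ℕ→ℚ (N C (2 ℕ.+ j) ℕ.+ ((N C (1 ℕ.+ j) ℕ.+ N C (1 ℕ.+ j)) ℕ.+ N C j)) * y
      ≡⟨ ℕ→ℚ-+-* (N C (2 ℕ.+ j)) _ y ⟩
    t (2 ℕ.+ j) n + ℕ→ℚ ((N C (1 ℕ.+ j) ℕ.+ N C (1 ℕ.+ j)) ℕ.+ N C j) * y
      ≡⟨ cong (λ q → t (2 ℕ.+ j) n + q) (ℕ→ℚ-+-* (N C (1 ℕ.+ j) ℕ.+ N C (1 ℕ.+ j)) (N C j) y) ⟩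
    t (2 ℕ.+ j) n + (ℕ→ℚ (N C (1 ℕ.+ j) ℕ.+ N C (1 ℕ.+ j)) * y + t j n)
      ≡⟨ cong (λ q → t (2 ℕ.+ j) n + (q + t j n)) (ℕ→ℚ-+-* (N C (1 ℕ.+ j)) (N C (1 ℕ.+ j)) y) ⟩
    t (2 ℕ.+ j) n + ((t (1 ℕ.+ j) n + t (1 ℕ.+ j) n) + t j n)
      ∎))
  where
  open ≡-Reasoning
  N = 2 ℕ.* n
  y = x ^ℚ n

-- σ, fibℚ and lucasℚ are opaque: letting the conversion checker unfold them (σ into rational
-- arithmetic, fib and lucas along numeral offsets) makes type checking blow up.
opaque
  mutual
    -- 9/4 = 1/(1 − x)
    σ : ℕ → ℚ
    σ j = + 9 / 4 * (t j 1 + x * σ-lower j)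

    σ-lower : ℕ → ℚ
    σ-lower zero          = 0ℚ
    σ-lower (suc zero)    = σ 0 + σ 0
    σ-lower (suc (suc j)) = (σ (suc j) + σ (suc j)) + σ j

opaque
  unfolding σ

  mutual
    hasSum-t : ∀ j → HasSum (t j) (σ j)
    hasSum-t j = hasSum-recurrence {x} {+ 9 / 4} refl (t-step j) (t⟶0 j) (hasSum-lower j)

    hasSum-lower : ∀ j → HasSum (lower j) (σ-lower j)
    hasSum-lower zero          = hasSum-0
    hasSum-lower (suc zero)    = hasSum-+ {t 0} {t 0} {σ 0} {σ 0} (hasSum-t 0) (hasSum-t 0)
    hasSum-lower (suc (suc j)) =
      hasSum-+ {λ n → t (suc j) n + t (suc j) n} {t j} {σ (suc j) + σ (suc j)} {σ j}
        (hasSum-+ {t (suc j)} {t (suc j)} {σ (suc j)} {σ (suc j)} (hasSum-t (suc j)) (hasSum-t (suc j))) (hasSum-t j)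

  σ-step : ∀ j → σ (3 ℕ.+ j) ≡ + 5 / 4 * ((σ (2 ℕ.+ j) + σ (2 ℕ.+ j)) + σ (1 ℕ.+ j))
  σ-step j = simplify ((σ (2 ℕ.+ j) + σ (2 ℕ.+ j)) + σ (1 ℕ.+ j))
    where
    simplify : ∀ s → + 9 / 4 * (0ℚ + x * s) ≡ + 5 / 4 * s
    simplify = solve-∀ ℚ-ring

  σ-initial : σ 1 ≡ + 45 / 8 × σ 2 ≡ + 135 / 8
  σ-initial = refl , refl

ℕ→ℚ-absorption : ∀ N j → ℕ→ℚ N * ℕ→ℚ (N C j) ≡ ℕ→ℚ j * ℕ→ℚ (N C j) + ℕ→ℚ (suc j) * ℕ→ℚ (N C suc j)
ℕ→ℚ-absorption N j = begin
    ℕ→ℚ N * ℕ→ℚ (N C j)                                      ≡⟨ ℕ→ℚ-* N (N C j) ⟨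
    ℕ→ℚ (N ℕ.* (N C j))                                      ≡⟨ cong ℕ→ℚ (n*nCk≡k*nCk+[k+1]*nC[k+1] N j) ⟩
    ℕ→ℚ (j ℕ.* (N C j) ℕ.+ suc j ℕ.* (N C suc j))            ≡⟨ ℕ→ℚ-+ (j ℕ.* (N C j)) _ ⟩
    ℕ→ℚ (j ℕ.* (N C j)) + ℕ→ℚ (suc j ℕ.* (N C suc j))        ≡⟨ cong₂ _+_ (ℕ→ℚ-* j (N C j)) (ℕ→ℚ-* (suc j) (N C suc j)) ⟩
    ℕ→ℚ j * ℕ→ℚ (N C j) + ℕ→ℚ (suc j) * ℕ→ℚ (N C suc j)      ∎
  where open ≡-Reasoning

even-term : ∀ j n → ℕ→ℚ n * ℕ→ℚ ((2 ℕ.* n) C j) * x ^ℚ n ≡ ½ * (ℕ→ℚ j * t j n + ℕ→ℚ (suc j) * t (suc j) n)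
even-term j n = begin
    m * c * y                              ≡⟨ halve m c y ⟩
    ½ * (ℕ→ℚ 2 * m * c) * y                ≡⟨ cong (λ v → ½ * (v * c) * y) (ℕ→ℚ-* 2 n) ⟨
    ½ * (ℕ→ℚ (2 ℕ.* n) * c) * y            ≡⟨ cong (λ v → ½ * v * y) (ℕ→ℚ-absorption (2 ℕ.* n) j) ⟩
    ½ * (κ * c + κ′ * c′) * y              ≡⟨ distribute κ κ′ c c′ y ⟩
    ½ * (κ * (c * y) + κ′ * (c′ * y))      ∎
  where
  open ≡-Reasoning
  m = ℕ→ℚ n
  c = ℕ→ℚ ((2 ℕ.* n) C j)
  c′ = ℕ→ℚ ((2 ℕ.* n) C suc j)
  y = x ^ℚ n
  κ = ℕ→ℚ j
  κ′ = ℕ→ℚ (suc j)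
  halve : ∀ m c y → m * c * y ≡ ½ * (ℕ→ℚ 2 * m * c) * y
  halve = solve-∀ ℚ-ring
  distribute : ∀ κ κ′ c c′ y → ½ * (κ * c + κ′ * c′) * y ≡ ½ * (κ * (c * y) + κ′ * (c′ * y))
  distribute = solve-∀ ℚ-ring

u : ℕ → ℕ → ℚ
u j n = ℕ→ℚ ((2 ℕ.* n ℕ.+ 1) C j) * x ^ℚ n

odd-term : ∀ j n → ℕ→ℚ n * ℕ→ℚ ((2 ℕ.* n ℕ.+ 1) C j) * x ^ℚ n ≡ ½ * (ℕ→ℚ j * u j n + ℕ→ℚ (suc j) * u (suc j) n - u j n)
odd-term j n = begin
    m * c * y                                        ≡⟨ halve m c y ⟩
    ½ * ((ℕ→ℚ 2 * m + 1ℚ) * c - c) * y               ≡⟨ cong (λ v → ½ * (v * c - c) * y) N≡2m+1 ⟨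
    ½ * (ℕ→ℚ N * c - c) * y                          ≡⟨ cong (λ v → ½ * (v - c) * y) (ℕ→ℚ-absorption N j) ⟩
    ½ * (κ * c + κ′ * c′ - c) * y                    ≡⟨ distribute κ κ′ c c′ y ⟩
    ½ * (κ * (c * y) + κ′ * (c′ * y) - c * y)        ∎
  where
  open ≡-Reasoning
  N = 2 ℕ.* n ℕ.+ 1
  m = ℕ→ℚ n
  c = ℕ→ℚ (N C j)
  c′ = ℕ→ℚ (N C suc j)
  y = x ^ℚ n
  κ = ℕ→ℚ j
  κ′ = ℕ→ℚ (suc j)
  N≡2m+1 : ℕ→ℚ N ≡ ℕ→ℚ 2 * m + 1ℚ
  N≡2m+1 = trans (ℕ→ℚ-+ (2 ℕ.* n) 1) (cong (_+ 1ℚ) (ℕ→ℚ-* 2 n))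
  halve : ∀ m c y → m * c * y ≡ ½ * ((ℕ→ℚ 2 * m + 1ℚ) * c - c) * y
  halve = solve-∀ ℚ-ring
  distribute : ∀ κ κ′ c c′ y → ½ * (κ * c + κ′ * c′ - c) * y ≡ ½ * (κ * (c * y) + κ′ * (c′ * y) - c * y)
  distribute = solve-∀ ℚ-ring

ρ : ℕ → ℚ
ρ zero    = σ 0
ρ (suc j) = σ j + σ (suc j)

hasSum-u : ∀ j → HasSum (u j) (ρ j)
hasSum-u zero    = hasSum-t 0
hasSum-u (suc j) = hasSum-cong u≡t+t (hasSum-+ (hasSum-t j) (hasSum-t (suc j)))
  where
  u≡t+t : ∀ n → t j n + t (suc j) n ≡ u (suc j) n
  u≡t+t n = begin
    t j n + t (suc j) n                                      ≡⟨ ℕ→ℚ-+-* ((2 ℕ.* n) C j) _ (x ^ℚ n) ⟨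
    ℕ→ℚ ((2 ℕ.* n) C j ℕ.+ (2 ℕ.* n) C suc j) * x ^ℚ n       ≡⟨ cong (λ m → ℕ→ℚ m * x ^ℚ n) (nCk+nC[k+1]≡[n+1]C[k+1] (2 ℕ.* n) j) ⟩
    ℕ→ℚ (suc (2 ℕ.* n) C suc j) * x ^ℚ n                     ≡⟨ cong (λ m → ℕ→ℚ (m C suc j) * x ^ℚ n) (ℕ.+-comm 1 (2 ℕ.* n)) ⟩
    u (suc j) n                                              ∎
    where open ≡-Reasoning

even-sum : ℕ → ℚ
even-sum j = ½ * (ℕ→ℚ j * σ j + ℕ→ℚ (suc j) * σ (suc j))

odd-sum : ℕ → ℚ
odd-sum j = ½ * (ℕ→ℚ j * ρ j + ℕ→ℚ (suc j) * ρ (suc j) - ρ j)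

hasSum-even : ∀ j → HasSum (λ n → ℕ→ℚ n * ℕ→ℚ ((2 ℕ.* n) C j) * x ^ℚ n) (even-sum j)
hasSum-even j = hasSum-cong (λ n → sym (even-term j n)) combination
  where
  combination : HasSum (λ n → ½ * (ℕ→ℚ j * t j n + ℕ→ℚ (suc j) * t (suc j) n)) (even-sum j)
  combination = hasSum-* ½ (hasSum-+ (hasSum-* (ℕ→ℚ j) (hasSum-t j)) (hasSum-* (ℕ→ℚ (suc j)) (hasSum-t (suc j))))

hasSum-odd : ∀ j → HasSum (λ n → ℕ→ℚ n * ℕ→ℚ ((2 ℕ.* n ℕ.+ 1) C j) * x ^ℚ n) (odd-sum j)
hasSum-odd j = hasSum-cong (λ n → sym (odd-term j n)) combination
  where
  combination : HasSum (λ n → ½ * (ℕ→ℚ j * u j n + ℕ→ℚ (suc j) * u (suc j) n - u j n)) (odd-sum j)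
  combination = hasSum-* ½ (hasSum-- (hasSum-+ (hasSum-* (ℕ→ℚ j) (hasSum-u j))
                                                (hasSum-* (ℕ→ℚ (suc j)) (hasSum-u (suc j))))
                                     (hasSum-u j))

-- Closed forms

opaque
  fibℚ lucasℚ : ℕ → ℚ
  fibℚ n = ℕ→ℚ (fib n)
  lucasℚ n = ℕ→ℚ (lucas n)

opaque
  unfolding fibℚ lucasℚ

  fibℚ-def : ∀ n → fibℚ n ≡ ℕ→ℚ (fib n)
  fibℚ-def n = refl

  lucasℚ-def : ∀ n → lucasℚ n ≡ ℕ→ℚ (lucas n)
  lucasℚ-def n = refl

  fibℚ[4+n]≡lucasℚ[2+n]+fibℚ[n] : ∀ n → fibℚ (4 ℕ.+ n) ≡ lucasℚ (2 ℕ.+ n) + fibℚ n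
  fibℚ[4+n]≡lucasℚ[2+n]+fibℚ[n] n = trans (cong ℕ→ℚ (fib[4+n]≡lucas[2+n]+fib[n] n)) (ℕ→ℚ-+ (lucas (2 ℕ.+ n)) (fib n))

  lucasℚ[4+n]≡5*fibℚ[2+n]+lucasℚ[n] : ∀ n → lucasℚ (4 ℕ.+ n) ≡ ℕ→ℚ 5 * fibℚ (2 ℕ.+ n) + lucasℚ n
  lucasℚ[4+n]≡5*fibℚ[2+n]+lucasℚ[n] n =
    trans (cong ℕ→ℚ (lucas[4+n]≡5*fib[2+n]+lucas[n] n))
      (trans (ℕ→ℚ-+ (5 ℕ.* fib (2 ℕ.+ n)) (lucas n)) (cong (_+ lucasℚ n) (ℕ→ℚ-* 5 (fib (2 ℕ.+ n)))))

  fibLikeℚ-+ : ∀ X → FibLike X → ∀ c n →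
               ℕ→ℚ (X (suc c ℕ.+ n)) ≡ ℕ→ℚ (X c) * fibℚ n + ℕ→ℚ (X (suc c)) * fibℚ (suc n)
  fibLikeℚ-+ X rec c n = trans (cong ℕ→ℚ (fibLike-+ X rec c n))
    (trans (ℕ→ℚ-+ (X c ℕ.* fib n) (X (suc c) ℕ.* fib (suc n))) (cong₂ _+_ (ℕ→ℚ-* (X c) (fib n)) (ℕ→ℚ-* (X (suc c)) (fib (suc n)))))

  fibℚ-+ : ∀ c n → fibℚ (suc c ℕ.+ n) ≡ ℕ→ℚ (fib c) * fibℚ n + ℕ→ℚ (fib (suc c)) * fibℚ (suc n)
  fibℚ-+ = fibLikeℚ-+ fib fib-fibLike

  lucasℚ-+ : ∀ c n → lucasℚ (suc c ℕ.+ n) ≡ ℕ→ℚ (lucas c) * fibℚ n + ℕ→ℚ (lucas (suc c)) * fibℚ (suc n)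
  lucasℚ-+ = fibLikeℚ-+ lucas lucas-fibLike

σ-closed : ∀ k → σ (1 ℕ.+ 2 ℕ.* k) ≡ (+ 5 / 4) ^ℚ k * (+ 15 / 8 * fibℚ (4 ℕ.+ 4 ℕ.* k))
               × σ (2 ℕ.+ 2 ℕ.* k) ≡ (+ 5 / 4) ^ℚ k * (+ 15 / 16 * lucasℚ (6 ℕ.+ 4 ℕ.* k))
σ-closed zero =
  subst (λ v → σ 1 ≡ 1ℚ * (+ 15 / 8 * v)) (sym (fibℚ-def 4)) (proj₁ σ-initial) ,
  subst (λ v → σ 2 ≡ 1ℚ * (+ 15 / 16 * v)) (sym (lucasℚ-def 6)) (proj₂ σ-initial)
σ-closed (suc k) = σ-odd , σ-even
  where
  open ≡-Reasoning
  p = (+ 5 / 4) ^ℚ k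
  n = 4 ℕ.* k
  step-odd : ∀ p F L → + 5 / 4 * ((p * (+ 15 / 16 * L) + p * (+ 15 / 16 * L)) + p * (+ 15 / 8 * F))
                     ≡ + 5 / 4 * p * (+ 15 / 8 * (L + F))
  step-odd = solve-∀ ℚ-ring
  step-even : ∀ p F L → + 5 / 4 * ((+ 5 / 4 * p * (+ 15 / 8 * F) + + 5 / 4 * p * (+ 15 / 8 * F)) + p * (+ 15 / 16 * L))
                      ≡ + 5 / 4 * p * (+ 15 / 16 * (ℕ→ℚ 5 * F + L))
  step-even = solve-∀ ℚ-ring
  σ₃ : σ (3 ℕ.+ 2 ℕ.* k) ≡ + 5 / 4 * p * (+ 15 / 8 * fibℚ (8 ℕ.+ n))
  σ₃ = begin
    σ (3 ℕ.+ 2 ℕ.* k)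
      ≡⟨ σ-step (2 ℕ.* k) ⟩
    + 5 / 4 * ((σ (2 ℕ.+ 2 ℕ.* k) + σ (2 ℕ.+ 2 ℕ.* k)) + σ (1 ℕ.+ 2 ℕ.* k))
      ≡⟨ cong₂ (λ a b → + 5 / 4 * ((a + a) + b)) (proj₂ (σ-closed k)) (proj₁ (σ-closed k)) ⟩
    + 5 / 4 * ((p * (+ 15 / 16 * lucasℚ (6 ℕ.+ n)) + p * (+ 15 / 16 * lucasℚ (6 ℕ.+ n))) + p * (+ 15 / 8 * fibℚ (4 ℕ.+ n)))
      ≡⟨ step-odd p (fibℚ (4 ℕ.+ n)) (lucasℚ (6 ℕ.+ n)) ⟩
    + 5 / 4 * p * (+ 15 / 8 * (lucasℚ (6 ℕ.+ n) + fibℚ (4 ℕ.+ n)))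
      ≡⟨ cong (λ v → + 5 / 4 * p * (+ 15 / 8 * v)) (fibℚ[4+n]≡lucasℚ[2+n]+fibℚ[n] (4 ℕ.+ n)) ⟨
    + 5 / 4 * p * (+ 15 / 8 * fibℚ (8 ℕ.+ n))
      ∎
  σ-odd : σ (1 ℕ.+ 2 ℕ.* suc k) ≡ (+ 5 / 4) ^ℚ suc k * (+ 15 / 8 * fibℚ (4 ℕ.+ 4 ℕ.* suc k))
  σ-odd = begin
    σ (1 ℕ.+ 2 ℕ.* suc k)                         ≡⟨ cong (λ i → σ (1 ℕ.+ i)) (ℕ.*-suc 2 k) ⟩
    σ (3 ℕ.+ 2 ℕ.* k)                             ≡⟨ σ₃ ⟩
    + 5 / 4 * p * (+ 15 / 8 * fibℚ (8 ℕ.+ n))     ≡⟨ cong (λ i → + 5 / 4 * p * (+ 15 / 8 * fibℚ (4 ℕ.+ i))) (ℕ.*-suc 4 k) ⟨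
    (+ 5 / 4) ^ℚ suc k * (+ 15 / 8 * fibℚ (4 ℕ.+ 4 ℕ.* suc k)) ∎
  σ-even : σ (2 ℕ.+ 2 ℕ.* suc k) ≡ (+ 5 / 4) ^ℚ suc k * (+ 15 / 16 * lucasℚ (6 ℕ.+ 4 ℕ.* suc k))
  σ-even = begin
    σ (2 ℕ.+ 2 ℕ.* suc k)
      ≡⟨ cong (λ i → σ (2 ℕ.+ i)) (ℕ.*-suc 2 k) ⟩
    σ (4 ℕ.+ 2 ℕ.* k)
      ≡⟨ σ-step (1 ℕ.+ 2 ℕ.* k) ⟩
    + 5 / 4 * ((σ (3 ℕ.+ 2 ℕ.* k) + σ (3 ℕ.+ 2 ℕ.* k)) + σ (2 ℕ.+ 2 ℕ.* k))
      ≡⟨ cong₂ (λ a b → + 5 / 4 * ((a + a) + b)) σ₃ (proj₂ (σ-closed k)) ⟩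
    + 5 / 4 * ((+ 5 / 4 * p * (+ 15 / 8 * fibℚ (8 ℕ.+ n)) + + 5 / 4 * p * (+ 15 / 8 * fibℚ (8 ℕ.+ n))) + p * (+ 15 / 16 * lucasℚ (6 ℕ.+ n)))
      ≡⟨ step-even p (fibℚ (8 ℕ.+ n)) (lucasℚ (6 ℕ.+ n)) ⟩
    + 5 / 4 * p * (+ 15 / 16 * (ℕ→ℚ 5 * fibℚ (8 ℕ.+ n) + lucasℚ (6 ℕ.+ n)))
      ≡⟨ cong (λ v → + 5 / 4 * p * (+ 15 / 16 * v)) (lucasℚ[4+n]≡5*fibℚ[2+n]+lucasℚ[n] (6 ℕ.+ n)) ⟨
    + 5 / 4 * p * (+ 15 / 16 * lucasℚ (10 ℕ.+ n))
      ≡⟨ cong (λ i → + 5 / 4 * p * (+ 15 / 16 * lucasℚ (6 ℕ.+ i))) (ℕ.*-suc 4 k) ⟨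
    (+ 5 / 4) ^ℚ suc k * (+ 15 / 16 * lucasℚ (6 ℕ.+ 4 ℕ.* suc k))
      ∎

σ[1+2k]-basis : ∀ k → σ (1 ℕ.+ 2 ℕ.* k)
  ≡ (+ 5 / 4) ^ℚ k * (+ 15 / 8 * (ℕ→ℚ (fib 3) * fibℚ (4 ℕ.* k) + ℕ→ℚ (fib 4) * fibℚ (suc (4 ℕ.* k))))
σ[1+2k]-basis k = trans (proj₁ (σ-closed k)) (cong (λ v → (+ 5 / 4) ^ℚ k * (+ 15 / 8 * v)) (fibℚ-+ 3 (4 ℕ.* k)))

σ[2+2k]-basis : ∀ k → σ (2 ℕ.+ 2 ℕ.* k)
  ≡ (+ 5 / 4) ^ℚ k * (+ 15 / 16 * (ℕ→ℚ (lucas 5) * fibℚ (4 ℕ.* k) + ℕ→ℚ (lucas 6) * fibℚ (suc (4 ℕ.* k))))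
σ[2+2k]-basis k = trans (proj₂ (σ-closed k)) (cong (λ v → (+ 5 / 4) ^ℚ k * (+ 15 / 16 * v)) (lucasℚ-+ 5 (4 ℕ.* k)))

4[1+k]+c≡[4+c]+4k : ∀ k c → 4 ℕ.* suc k ℕ.+ c ≡ suc (3 ℕ.+ c) ℕ.+ 4 ℕ.* k
4[1+k]+c≡[4+c]+4k = NatSolver.solve-∀

fib[4[1+k]+c]-basis : ∀ k c → ℕ→ℚ (fib (4 ℕ.* suc k ℕ.+ c))
  ≡ ℕ→ℚ (fib (3 ℕ.+ c)) * fibℚ (4 ℕ.* k) + ℕ→ℚ (fib (4 ℕ.+ c)) * fibℚ (suc (4 ℕ.* k))
fib[4[1+k]+c]-basis k c =
  trans (sym (fibℚ-def _)) (trans (cong fibℚ (4[1+k]+c≡[4+c]+4k k c)) (fibℚ-+ (3 ℕ.+ c) (4 ℕ.* k)))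

lucas[4[1+k]+c]-basis : ∀ k c → ℕ→ℚ (lucas (4 ℕ.* suc k ℕ.+ c))
  ≡ ℕ→ℚ (lucas (3 ℕ.+ c)) * fibℚ (4 ℕ.* k) + ℕ→ℚ (lucas (4 ℕ.+ c)) * fibℚ (suc (4 ℕ.* k))
lucas[4[1+k]+c]-basis k c =
  trans (sym (lucasℚ-def _)) (trans (cong lucasℚ (4[1+k]+c≡[4+c]+4k k c)) (lucasℚ-+ (3 ℕ.+ c) (4 ℕ.* k)))

-- Each hypothesis substitutes a quantity by its expression in p = (5/4)ᵏ, κ = k, α = F(4k), β = F(4k+1),
-- after which the claim is a polynomial identity.
odd-sum[2m]-algebra : ∀ p κ α β {J J′ μ s₁ s₂ s₃ N A B} →
  J ≡ ℕ→ℚ 2 + ℕ→ℚ 2 * κ → J′ ≡ 1ℚ + J → μ ≡ 1ℚ + κ →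
  s₁ ≡ p * (+ 15 / 8 * (ℕ→ℚ (fib 3) * α + ℕ→ℚ (fib 4) * β)) →
  s₂ ≡ p * (+ 15 / 16 * (ℕ→ℚ (lucas 5) * α + ℕ→ℚ (lucas 6) * β)) →
  s₃ ≡ + 5 / 4 * ((s₂ + s₂) + s₁) →
  N ≡ ℕ→ℚ 6 * μ + ℕ→ℚ 3 → A ≡ ℕ→ℚ (fib 7) * α + ℕ→ℚ (fib 8) * β → B ≡ ℕ→ℚ (fib 5) * α + ℕ→ℚ (fib 6) * β →
  ½ * (J * (s₁ + s₂) + J′ * (s₂ + s₃) - (s₁ + s₂)) ≡ + 9 / 16 * (+ 5 / 4 * p) * (N * A - ℕ→ℚ 4 * B)
odd-sum[2m]-algebra p κ α β refl refl refl refl refl refl refl refl refl = solve (p ∷ κ ∷ α ∷ β ∷ []) ℚ-ring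

odd-sum[2m+1]-algebra : ∀ p κ α β {J J′ μ s₁ s₂ s₃ s₄ N A B} →
  J ≡ ℕ→ℚ 3 + ℕ→ℚ 2 * κ → J′ ≡ 1ℚ + J → μ ≡ 1ℚ + κ →
  s₁ ≡ p * (+ 15 / 8 * (ℕ→ℚ (fib 3) * α + ℕ→ℚ (fib 4) * β)) →
  s₂ ≡ p * (+ 15 / 16 * (ℕ→ℚ (lucas 5) * α + ℕ→ℚ (lucas 6) * β)) →
  s₃ ≡ + 5 / 4 * ((s₂ + s₂) + s₁) → s₄ ≡ + 5 / 4 * ((s₃ + s₃) + s₂) →
  N ≡ ℕ→ℚ 6 * μ + ℕ→ℚ 6 → A ≡ ℕ→ℚ (lucas 9) * α + ℕ→ℚ (lucas 10) * β → B ≡ ℕ→ℚ (lucas 7) * α + ℕ→ℚ (lucas 8) * β →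
  ½ * (J * (s₂ + s₃) + J′ * (s₃ + s₄) - (s₂ + s₃)) ≡ + 9 / 32 * (+ 5 / 4 * p) * (N * A - ℕ→ℚ 4 * B)
odd-sum[2m+1]-algebra p κ α β refl refl refl refl refl refl refl refl refl refl = solve (p ∷ κ ∷ α ∷ β ∷ []) ℚ-ring

even-sum[2m]-algebra : ∀ p κ α β {J J′ μ s₁ s₂ s₃ N A B} →
  J ≡ ℕ→ℚ 2 + ℕ→ℚ 2 * κ → J′ ≡ 1ℚ + J → μ ≡ 1ℚ + κ →
  s₁ ≡ p * (+ 15 / 8 * (ℕ→ℚ (fib 3) * α + ℕ→ℚ (fib 4) * β)) →
  s₂ ≡ p * (+ 15 / 16 * (ℕ→ℚ (lucas 5) * α + ℕ→ℚ (lucas 6) * β)) →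
  s₃ ≡ + 5 / 4 * ((s₂ + s₂) + s₁) →
  N ≡ ℕ→ℚ 6 * μ + ℕ→ℚ 3 → A ≡ ℕ→ℚ (lucas 7) * α + ℕ→ℚ (lucas 8) * β → B ≡ ℕ→ℚ (lucas 5) * α + ℕ→ℚ (lucas 6) * β →
  ½ * (J * s₂ + J′ * s₃) ≡ + 3 / 16 * (+ 5 / 4 * p) * (N * A - ℕ→ℚ 2 * B)
even-sum[2m]-algebra p κ α β refl refl refl refl refl refl refl refl refl = solve (p ∷ κ ∷ α ∷ β ∷ []) ℚ-ring

even-sum[2m+1]-algebra : ∀ p κ α β {J J′ μ s₁ s₂ s₃ s₄ N A B} →
  J ≡ ℕ→ℚ 3 + ℕ→ℚ 2 * κ → J′ ≡ 1ℚ + J → μ ≡ 1ℚ + κ →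
  s₁ ≡ p * (+ 15 / 8 * (ℕ→ℚ (fib 3) * α + ℕ→ℚ (fib 4) * β)) →
  s₂ ≡ p * (+ 15 / 16 * (ℕ→ℚ (lucas 5) * α + ℕ→ℚ (lucas 6) * β)) →
  s₃ ≡ + 5 / 4 * ((s₂ + s₂) + s₁) → s₄ ≡ + 5 / 4 * ((s₃ + s₃) + s₂) →
  N ≡ ℕ→ℚ 3 * μ + ℕ→ℚ 3 → A ≡ ℕ→ℚ (fib 9) * α + ℕ→ℚ (fib 10) * β → B ≡ ℕ→ℚ (fib 7) * α + ℕ→ℚ (fib 8) * β →
  ½ * (J * s₃ + J′ * s₄) ≡ + 15 / 16 * (+ 5 / 4 * p) * (N * A - B)
even-sum[2m+1]-algebra p κ α β refl refl refl refl refl refl refl refl refl refl = solve (p ∷ κ ∷ α ∷ β ∷ []) ℚ-ring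

opaque
  unfolding σ

  sums-at-0 : odd-sum 0 ≡ + 45 / 16 × odd-sum 1 ≡ + 45 / 2 × even-sum 0 ≡ + 45 / 16 × even-sum 1 ≡ + 315 / 16
  sums-at-0 = refl , refl , refl , refl

2[1+k]+1≡3+2k : ∀ k → 2 ℕ.* suc k ℕ.+ 1 ≡ 3 ℕ.+ 2 ℕ.* k
2[1+k]+1≡3+2k = NatSolver.solve-∀

odd-sum[2m]-closed : ∀ m → odd-sum (2 ℕ.* m) ≡
  (+ 9 / 16) * ((+ 5 / 4) ^ℚ m) * (ℕ→ℚ (6 ℕ.* m ℕ.+ 3) * ℕ→ℚ (fib (4 ℕ.* m ℕ.+ 4)) - ℕ→ℚ 4 * ℕ→ℚ (fib (4 ℕ.* m ℕ.+ 2)))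
odd-sum[2m]-closed zero    = proj₁ sums-at-0
odd-sum[2m]-closed (suc k) = trans (cong odd-sum (ℕ.*-suc 2 k))
  (odd-sum[2m]-algebra ((+ 5 / 4) ^ℚ k) (ℕ→ℚ k) (fibℚ (4 ℕ.* k)) (fibℚ (suc (4 ℕ.* k)))
    (ℕ→ℚ-c+a*k 2 2 k) (ℕ→ℚ-suc (2 ℕ.+ 2 ℕ.* k)) (ℕ→ℚ-suc k)
    (σ[1+2k]-basis k) (σ[2+2k]-basis k) (σ-step (2 ℕ.* k))
    (ℕ→ℚ-a*k+c 6 (suc k) 3) (fib[4[1+k]+c]-basis k 4) (fib[4[1+k]+c]-basis k 2))

odd-sum[2m+1]-closed : ∀ m → odd-sum (2 ℕ.* m ℕ.+ 1) ≡
  (+ 9 / 32) * ((+ 5 / 4) ^ℚ m) * (ℕ→ℚ (6 ℕ.* m ℕ.+ 6) * ℕ→ℚ (lucas (4 ℕ.* m ℕ.+ 6)) - ℕ→ℚ 4 * ℕ→ℚ (lucas (4 ℕ.* m ℕ.+ 4)))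
odd-sum[2m+1]-closed zero    = proj₁ (proj₂ sums-at-0)
odd-sum[2m+1]-closed (suc k) = trans (cong odd-sum (2[1+k]+1≡3+2k k))
  (odd-sum[2m+1]-algebra ((+ 5 / 4) ^ℚ k) (ℕ→ℚ k) (fibℚ (4 ℕ.* k)) (fibℚ (suc (4 ℕ.* k)))
    (ℕ→ℚ-c+a*k 3 2 k) (ℕ→ℚ-suc (3 ℕ.+ 2 ℕ.* k)) (ℕ→ℚ-suc k)
    (σ[1+2k]-basis k) (σ[2+2k]-basis k) (σ-step (2 ℕ.* k)) (σ-step (1 ℕ.+ 2 ℕ.* k))
    (ℕ→ℚ-a*k+c 6 (suc k) 6) (lucas[4[1+k]+c]-basis k 6) (lucas[4[1+k]+c]-basis k 4))

even-sum[2m]-closed : ∀ m → even-sum (2 ℕ.* m) ≡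
  (+ 3 / 16) * ((+ 5 / 4) ^ℚ m) * (ℕ→ℚ (6 ℕ.* m ℕ.+ 3) * ℕ→ℚ (lucas (4 ℕ.* m ℕ.+ 4)) - ℕ→ℚ 2 * ℕ→ℚ (lucas (4 ℕ.* m ℕ.+ 2)))
even-sum[2m]-closed zero    = proj₁ (proj₂ (proj₂ sums-at-0))
even-sum[2m]-closed (suc k) = trans (cong even-sum (ℕ.*-suc 2 k))
  (even-sum[2m]-algebra ((+ 5 / 4) ^ℚ k) (ℕ→ℚ k) (fibℚ (4 ℕ.* k)) (fibℚ (suc (4 ℕ.* k)))
    (ℕ→ℚ-c+a*k 2 2 k) (ℕ→ℚ-suc (2 ℕ.+ 2 ℕ.* k)) (ℕ→ℚ-suc k)
    (σ[1+2k]-basis k) (σ[2+2k]-basis k) (σ-step (2 ℕ.* k))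
    (ℕ→ℚ-a*k+c 6 (suc k) 3) (lucas[4[1+k]+c]-basis k 4) (lucas[4[1+k]+c]-basis k 2))

even-sum[2m+1]-closed : ∀ m → even-sum (2 ℕ.* m ℕ.+ 1) ≡
  (+ 15 / 16) * ((+ 5 / 4) ^ℚ m) * (ℕ→ℚ (3 ℕ.* m ℕ.+ 3) * ℕ→ℚ (fib (4 ℕ.* m ℕ.+ 6)) - ℕ→ℚ (fib (4 ℕ.* m ℕ.+ 4)))
even-sum[2m+1]-closed zero    = proj₂ (proj₂ (proj₂ sums-at-0))
even-sum[2m+1]-closed (suc k) = trans (cong even-sum (2[1+k]+1≡3+2k k))
  (even-sum[2m+1]-algebra ((+ 5 / 4) ^ℚ k) (ℕ→ℚ k) (fibℚ (4 ℕ.* k)) (fibℚ (suc (4 ℕ.* k)))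
    (ℕ→ℚ-c+a*k 3 2 k) (ℕ→ℚ-suc (3 ℕ.+ 2 ℕ.* k)) (ℕ→ℚ-suc k)
    (σ[1+2k]-basis k) (σ[2+2k]-basis k) (σ-step (2 ℕ.* k)) (σ-step (1 ℕ.+ 2 ℕ.* k))
    (ℕ→ℚ-a*k+c 3 (suc k) 3) (fib[4[1+k]+c]-basis k 6) (fib[4[1+k]+c]-basis k 4))

theorem6 : ∀ (m : ℕ) →
    HasSum (λ n → ℕ→ℚ n * ℕ→ℚ ((2 ℕ.* n ℕ.+ 1) C (2 ℕ.* m)) * ((+ 5 / 9) ^ℚ n))
           ((+ 9 / 16) * ((+ 5 / 4) ^ℚ m) * (ℕ→ℚ (6 ℕ.* m ℕ.+ 3) * ℕ→ℚ (fib (4 ℕ.* m ℕ.+ 4)) - ℕ→ℚ 4 * ℕ→ℚ (fib (4 ℕ.* m ℕ.+ 2))))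
  × HasSum (λ n → ℕ→ℚ n * ℕ→ℚ ((2 ℕ.* n ℕ.+ 1) C (2 ℕ.* m ℕ.+ 1)) * ((+ 5 / 9) ^ℚ n))
           ((+ 9 / 32) * ((+ 5 / 4) ^ℚ m) * (ℕ→ℚ (6 ℕ.* m ℕ.+ 6) * ℕ→ℚ (lucas (4 ℕ.* m ℕ.+ 6)) - ℕ→ℚ 4 * ℕ→ℚ (lucas (4 ℕ.* m ℕ.+ 4))))
  × HasSum (λ n → ℕ→ℚ n * ℕ→ℚ ((2 ℕ.* n) C (2 ℕ.* m)) * ((+ 5 / 9) ^ℚ n))
           ((+ 3 / 16) * ((+ 5 / 4) ^ℚ m) * (ℕ→ℚ (6 ℕ.* m ℕ.+ 3) * ℕ→ℚ (lucas (4 ℕ.* m ℕ.+ 4)) - ℕ→ℚ 2 * ℕ→ℚ (lucas (4 ℕ.* m ℕ.+ 2))))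
  × HasSum (λ n → ℕ→ℚ n * ℕ→ℚ ((2 ℕ.* n) C (2 ℕ.* m ℕ.+ 1)) * ((+ 5 / 9) ^ℚ n))
           ((+ 15 / 16) * ((+ 5 / 4) ^ℚ m) * (ℕ→ℚ (3 ℕ.* m ℕ.+ 3) * ℕ→ℚ (fib (4 ℕ.* m ℕ.+ 6)) - ℕ→ℚ (fib (4 ℕ.* m ℕ.+ 4))))
theorem6 m =
    subst (HasSum _) (odd-sum[2m]-closed m) (hasSum-odd (2 ℕ.* m))
  , subst (HasSum _) (odd-sum[2m+1]-closed m) (hasSum-odd (2 ℕ.* m ℕ.+ 1))
  , subst (HasSum _) (even-sum[2m]-closed m) (hasSum-even (2 ℕ.* m))
  , subst (HasSum _) (even-sum[2m+1]-closed m) (hasSum-even (2 ℕ.* m ℕ.+ 1))
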